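{- Let $n,r$ be positive integers with $\gcd(r,n)=1$, let $G_r=2^r+1$, and let $e$ be the least positive residue of the inverse of $r$ modulo $n$. Let $a\in\{1,\dots,2^n-2\}$ and let $(a_0,\dots,a_{n-1})\in\{0,1\}^n$ be given by $a_i=\alpha_{(-ir)\bmod n}$, where $a=\sum_{m=0}^{n-1}\alpha_m2^m$ is the binary expansion (so $a\equiv\sum_{i=0}^{n-1}a_i2^{ -ir}\pmod{2^n-1}$). The following are equivalent: (a) $a$ is the inverse of $G_r$ modulo $2^n-1$; (b) there exists a sequence $(c_0,\dots,c_{n-1})$ with $c_i\in\{0,1\}$ such that $$2c_0-c_e+1=a_1+a_0,\qquad 2c_i-c_{i+e}=a_{i+1}+a_i\ \text{ for all } i\in\mathbb{Z}_n,\ i\ne0,$$ where indices are taken modulo $n$. Moreover, the sequence $c$ in (b) is unique.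
   Context: Powers $2^{m}$ with arbitrary integer $m$ are understood modulo $2^n-1$, i.e. $2^m=2^{m\bmod n}$. -}

module Defs where

open import Data.Nat using (ℕ; zero; suc; _+_; _*_; _∸_; _^_; _/_; _%_; NonZero)
open import Data.Nat.DivMod using (_mod_)
open import Data.Nat.Properties using (m^n≢0)
open import Data.Bool using (Bool; true; false)
open import Data.Vec using (Vec; lookup)
open import Data.Integer as ℤ using (ℤ)

bit : ℕ → ℕ → ℕ
bit a m = ((a / 2 ^ m) {{m^n≢0 2 m}}) % 2

aDigit : (n r a i : ℕ) → .{{_ : NonZero n}} → ℕ
aDigit n r a i = bit a ((n ∸ ((i * r) % n)) % n)

b2ℤ : Bool → ℤ
b2ℤ true  = ℤ.+ 1
b2ℤ false = ℤ.+ 0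

cAt : ∀ {n} .{{_ : NonZero n}} → Vec Bool n → ℕ → ℤ
cAt {n} c j = b2ℤ (lookup c (j mod n))

CondB : (n r e a : ℕ) → .{{_ : NonZero n}} → Vec Bool n → Set
CondB n r e a c =
  (ℤ.+ 2 ℤ.* cAt c 0 ℤ.- cAt c e ℤ.+ ℤ.+ 1
     ≡ ℤ.+ (aDigit n r a 1 + aDigit n r a 0))
  × (∀ i → 0 Data.Nat.< i → i Data.Nat.< n →
      ℤ.+ 2 ℤ.* cAt c i ℤ.- cAt c (i + e)
        ≡ ℤ.+ (aDigit n r a ((i + 1) % n) + aDigit n r a i))
  where
    open import Data.Product using (_×_)
    open import Relation.Binary.PropositionalEquality using (_≡_)

-- Let α_m be the binary digits of a and s_m = α_m + α_{m−r} (indices mod n). Multiplication by 2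
-- modulo M = 2^n − 1 rotates binary digits, so a G_r = a + 2^r a ≡ S := Σ_m s_m 2^m (mod M), and
-- 1 ≤ S ≤ 2M. Hence (a) holds iff S = B M + 1 for a bit B, i.e. S + B = 2^n B + 1: adding the digit
-- sums s_m with the carry B fed into position 0 yields the digits of 1 and the carry B out of the top
-- position. That happens iff there are carries d_m ∈ {0,1} with s_m + d_{m−1} = 2 d_m + [m = 0] and
-- d_{−1} = d_{n−1} = B; the carries are then determined one by one from B, which S determines.
-- Reindexing by m = −ir mod n gives s_m = a_{i+1} + a_i and m − 1 = −(i+e)r, so c_i = d_m turns this
-- system into (b).

module Submission where

open import Data.Bool using (Bool; true; false)
open import Data.Empty using (⊥-elim)
open import Data.Fin using (toℕ)
open import Data.Fin.Properties using (fromℕ<-cong; toℕ-injective; toℕ-fromℕ<; toℕ<n)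
open import Data.Integer as ℤ using (ℤ)
import Data.Integer.Properties as ℤ
import Data.Integer.Tactic.RingSolver as ℤ-Solver
open import Data.Nat
open import Data.Nat.Coprimality using (Coprime)
open import Data.Nat.Divisibility using (_∣_; divides; ∣m+n∣m⇒∣n; ∣m∣n⇒∣m+n; m∣m*n)
open import Data.Nat.DivMod
open import Data.Nat.Properties
open import Data.Nat.Tactic.RingSolver using (solve-∀)
open import Data.Product using (_×_; _,_; ∃; proj₁; proj₂)
open import Data.Sum using (inj₁; inj₂)
open import Data.Vec using (Vec; lookup; tabulate)
open import Data.Vec.Properties using (lookup∘tabulate; tabulate-cong; tabulate∘lookup)
open import Function using (_∘_; _⇔_; mk⇔; Equivalence)
open import Function.Properties.Equivalence using (⇔-setoid)
open import Level using (0ℓ)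
open import Relation.Binary.Bundles using (Setoid)
open import Relation.Binary.PropositionalEquality
import Relation.Binary.Reasoning.Setoid as SetoidReasoning
open import Relation.Binary.Structures using (IsEquivalence)

open import Defs

δ₀ : ℕ → ℕ
δ₀ zero    = 1
δ₀ (suc _) = 0

b2ℕ : Bool → ℕ
b2ℕ true  = 1
b2ℕ false = 0

fromBit : ℕ → Bool
fromBit zero    = false
fromBit (suc _) = true

b2ℕ≤1 : ∀ b → b2ℕ b ≤ 1
b2ℕ≤1 true  = ≤-refl
b2ℕ≤1 false = z≤n

b2ℕ-fromBit : ∀ {x} → x ≤ 1 → b2ℕ (fromBit x) ≡ x
b2ℕ-fromBit z≤n       = refl
b2ℕ-fromBit (s≤s z≤n) = refl

b2ℕ-injective : ∀ {b b′} → b2ℕ b ≡ b2ℕ b′ → b ≡ b′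
b2ℕ-injective {true}  {true}  _ = refl
b2ℕ-injective {false} {false} _ = refl

2*b2ℕ+t-injective : ∀ {b b′} t → 2 * b2ℕ b + t ≡ 2 * b2ℕ b′ + t → b ≡ b′
2*b2ℕ+t-injective {b} {b′} t eq =
  b2ℕ-injective (*-cancelˡ-≡ (b2ℕ b) (b2ℕ b′) 2 (+-cancelʳ-≡ t _ _ eq))

value : (ℕ → ℕ) → ℕ → ℕ
value d zero    = 0
value d (suc k) = value d k + 2 ^ k * d k

value-cong : ∀ {d d′} k → (∀ m → m < k → d m ≡ d′ m) → value d k ≡ value d′ k
value-cong zero    _  = refl
value-cong (suc k) eq =
  cong₂ (λ v x → v + 2 ^ k * x) (value-cong k (λ m m<k → eq m (m<n⇒m<1+n m<k))) (eq k ≤-refl)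

value-suc : ∀ d k → value d (suc k) ≡ d 0 + 2 * value (d ∘ suc) k
value-suc d zero    = refl
value-suc d (suc k) = begin
  value d (suc k) + 2 ^ suc k * d (suc k)                   ≡⟨ cong (_+ 2 ^ suc k * d (suc k)) (value-suc d k) ⟩
  d 0 + 2 * value (d ∘ suc) k + 2 * 2 ^ k * d (suc k)       ≡⟨ lemma (d 0) (value (d ∘ suc) k) (2 ^ k) (d (suc k)) ⟩
  d 0 + 2 * (value (d ∘ suc) k + 2 ^ k * d (suc k))         ∎
  where
  open ≡-Reasoning
  lemma : ∀ x v p y → x + 2 * v + 2 * p * y ≡ x + 2 * (v + p * y)
  lemma = solve-∀

value-+ : ∀ d d′ k → value (λ m → d m + d′ m) k ≡ value d k + value d′ k
value-+ d d′ zero    = refl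
value-+ d d′ (suc k) = begin
  value (λ m → d m + d′ m) k + 2 ^ k * (d k + d′ k)       ≡⟨ cong (_+ 2 ^ k * (d k + d′ k)) (value-+ d d′ k) ⟩
  value d k + value d′ k + 2 ^ k * (d k + d′ k)           ≡⟨ lemma (value d k) (value d′ k) (2 ^ k) (d k) (d′ k) ⟩
  value d k + 2 ^ k * d k + (value d′ k + 2 ^ k * d′ k)   ∎
  where
  open ≡-Reasoning
  lemma : ∀ v v′ p x x′ → v + v′ + p * (x + x′) ≡ v + p * x + (v′ + p * x′)
  lemma = solve-∀

value<2^ : ∀ d k → (∀ m → m < k → d m ≤ 1) → value d k < 2 ^ k
value<2^ d zero    _    = z<s
value<2^ d (suc k) d≤1 = begin-strict
  value d k + 2 ^ k * d k   <⟨ +-monoˡ-< _ (value<2^ d k (λ m m<k → d≤1 m (m<n⇒m<1+n m<k))) ⟩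
  2 ^ k + 2 ^ k * d k       ≤⟨ +-monoʳ-≤ (2 ^ k) (*-monoʳ-≤ (2 ^ k) (d≤1 k ≤-refl)) ⟩
  2 ^ k + 2 ^ k * 1         ≡⟨ cong (λ x → 2 ^ k + x) (*-identityʳ (2 ^ k)) ⟩
  2 ^ k + 2 ^ k             ≡⟨ cong (λ x → 2 ^ k + x) (+-identityʳ (2 ^ k)) ⟨
  2 ^ suc k                 ∎
  where open ≤-Reasoning

value≡0⇒≡0 : ∀ d k → value d k ≡ 0 → ∀ m → m < k → d m ≡ 0
value≡0⇒≡0 d (suc k) eq m m<1+k with m≤n⇒m<n∨m≡n (s≤s⁻¹ m<1+k)
... | inj₁ m<k  = value≡0⇒≡0 d k (m+n≡0⇒m≡0 (value d k) eq) m m<k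
... | inj₂ refl = m*n≡0⇒m≡0 (d m) (2 ^ m) {{m^n≢0 2 m}} (trans (*-comm (d m) (2 ^ m)) (m+n≡0⇒n≡0 (value d m) eq))

x+2y≡1⇒x≡1∧y≡0 : ∀ x y → x + 2 * y ≡ 1 → x ≡ 1 × y ≡ 0
x+2y≡1⇒x≡1∧y≡0 x zero    eq = trans (sym (+-identityʳ x)) eq , refl
x+2y≡1⇒x≡1∧y≡0 x (suc y) eq = ⊥-elim (<⇒≱ (s≤s (s≤s z≤n)) (begin
  2             ≤⟨ *-monoʳ-≤ 2 (s≤s (z≤n {y})) ⟩
  2 * suc y     ≤⟨ m≤n+m (2 * suc y) x ⟩
  x + 2 * suc y ≡⟨ eq ⟩
  1             ∎))
  where open ≤-Reasoning

value≡1⇒≡δ₀ : ∀ d k → value d (suc k) ≡ 1 → ∀ m → m < suc k → d m ≡ δ₀ m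
value≡1⇒≡δ₀ d k eq m m<1+k with x+2y≡1⇒x≡1∧y≡0 (d 0) (value (d ∘ suc) k) (trans (sym (value-suc d k)) eq)
value≡1⇒≡δ₀ d k eq zero    _     | d0≡1 , _     = d0≡1
value≡1⇒≡δ₀ d k eq (suc m) 1+m<  | _    , rest0 = value≡0⇒≡0 (d ∘ suc) k rest0 m (s≤s⁻¹ 1+m<)

value-δ₀ : ∀ k → value δ₀ (suc k) ≡ 1
value-δ₀ zero    = refl
value-δ₀ (suc k) = trans (cong₂ _+_ (value-δ₀ k) (*-zeroʳ (2 ^ suc k))) refl

value-carry : ∀ (s z c : ℕ → ℕ) k → (∀ m → m < k → s m + c m ≡ z m + 2 * c (suc m)) →
              value s k + c 0 ≡ value z k + 2 ^ k * c k
value-carry s z c zero    _    = sym (+-identityʳ (c 0))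
value-carry s z c (suc k) step = begin
  value s k + 2 ^ k * s k + c 0              ≡⟨ lemma₁ (value s k) (2 ^ k) (s k) (c 0) ⟩
  value s k + c 0 + 2 ^ k * s k              ≡⟨ cong (_+ 2 ^ k * s k) (value-carry s z c k (λ m m<k → step m (m<n⇒m<1+n m<k))) ⟩
  value z k + 2 ^ k * c k + 2 ^ k * s k      ≡⟨ lemma₂ (value z k) (2 ^ k) (c k) (s k) ⟩
  value z k + 2 ^ k * (s k + c k)            ≡⟨ cong (λ x → value z k + 2 ^ k * x) (step k ≤-refl) ⟩
  value z k + 2 ^ k * (z k + 2 * c (suc k))  ≡⟨ lemma₃ (value z k) (2 ^ k) (z k) (c (suc k)) ⟩
  value z k + 2 ^ k * z k + 2 * 2 ^ k * c (suc k) ∎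
  where
  open ≡-Reasoning
  lemma₁ : ∀ v p x y → v + p * x + y ≡ v + y + p * x
  lemma₁ = solve-∀
  lemma₂ : ∀ v p x y → v + p * x + p * y ≡ v + p * (y + x)
  lemma₂ = solve-∀
  lemma₃ : ∀ v p x y → v + p * (x + 2 * y) ≡ v + p * x + 2 * p * y
  lemma₃ = solve-∀

base-digit-unique : ∀ {P x y q q′} → x < P → y < P → x + P * q ≡ y + P * q′ → x ≡ y × q ≡ q′
base-digit-unique {P} {x} {y} {q} {q′} x<P y<P eq = x≡y , *-cancelˡ-≡ q q′ P (+-cancelˡ-≡ x _ _ eq′)
  where
  instance
    _ : NonZero P
    _ = >-nonZero (<-≤-trans z<s x<P)
  x≡y : x ≡ y
  x≡y = begin
    x                  ≡⟨ m<n⇒m%n≡m x<P ⟨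
    x % P              ≡⟨ [m+kn]%n≡m%n x q P ⟨
    (x + q * P) % P    ≡⟨ cong (λ t → (x + t) % P) (*-comm q P) ⟩
    (x + P * q) % P    ≡⟨ cong (_% P) eq ⟩
    (y + P * q′) % P   ≡⟨ cong (λ t → (y + t) % P) (*-comm P q′) ⟩
    (y + q′ * P) % P   ≡⟨ [m+kn]%n≡m%n y q′ P ⟩
    y % P              ≡⟨ m<n⇒m%n≡m y<P ⟩
    y                  ∎
    where open ≡-Reasoning
  eq′ : x + P * q ≡ x + P * q′
  eq′ = trans eq (cong (_+ P * q′) (sym x≡y))

bit≤1 : ∀ a m → bit a m ≤ 1
bit≤1 a m = s≤s⁻¹ (m%n<n ((a / 2 ^ m) {{m^n≢0 2 m}}) 2)

bit-suc : ∀ a m → bit a (suc m) ≡ bit (a / 2) m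
bit-suc a m = cong (_% 2) (sym (m/n/o≡m/[n*o] a 2 (2 ^ m) {{_}} {{m^n≢0 2 m}} {{m^n≢0 2 (suc m)}}))

value-bit : ∀ k a → a < 2 ^ k → value (bit a) k ≡ a
value-bit zero    zero    _           = refl
value-bit zero    (suc a) (s≤s ())
value-bit (suc k) a       a<2^1+k = begin
  value (bit a) (suc k)                   ≡⟨ value-suc (bit a) k ⟩
  bit a 0 + 2 * value (bit a ∘ suc) k     ≡⟨ cong₂ (λ x v → x + 2 * v) (cong (_% 2) (n/1≡n a)) (value-cong k (λ m _ → bit-suc a m)) ⟩
  a % 2 + 2 * value (bit (a / 2)) k       ≡⟨ cong (λ v → a % 2 + 2 * v) (value-bit k (a / 2) a/2<2^k) ⟩
  a % 2 + 2 * (a / 2)                     ≡⟨ cong (a % 2 +_) (*-comm 2 (a / 2)) ⟩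
  a % 2 + a / 2 * 2                       ≡⟨ m≡m%n+[m/n]*n a 2 ⟨
  a                                       ∎
  where
  open ≡-Reasoning
  a/2<2^k : a / 2 < 2 ^ k
  a/2<2^k = m<n*o⇒m/o<n (subst (a <_) (*-comm 2 (2 ^ k)) a<2^1+k)

∣∸1⇔ : ∀ {m k} .{{_ : NonZero m}} → 1 ≤ k → k ≤ m + m → (m ∣ k ∸ 1) ⇔ (∃ λ b → b ≤ 1 × k ≡ b * m + 1)
∣∸1⇔ {m} {k} 1≤k k≤2m = mk⇔ to from
  where
  to : m ∣ k ∸ 1 → ∃ λ b → b ≤ 1 × k ≡ b * m + 1
  to (divides q k∸1≡qm) = q , q≤1 , trans (sym (m∸n+n≡m 1≤k)) (cong (_+ 1) k∸1≡qm)
    where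
    q≤1 : q ≤ 1
    q≤1 = s≤s⁻¹ (*-cancelʳ-< m q 2 (begin-strict
      q * m     ≡⟨ k∸1≡qm ⟨
      k ∸ 1     <⟨ ∸-monoʳ-< z<s 1≤k ⟩
      k ∸ 0     ≤⟨ k≤2m ⟩
      m + m     ≡⟨ cong (m +_) (+-identityʳ m) ⟨
      2 * m     ∎))
      where open ≤-Reasoning
  from : (∃ λ b → b ≤ 1 × k ≡ b * m + 1) → m ∣ k ∸ 1
  from (b , _ , k≡bm+1) = divides b (trans (cong (_∸ 1) k≡bm+1) (m+n∸n≡m (b * m) 1))

∣[k+m*q]∸1⇔∣k∸1 : ∀ {m k} q → 1 ≤ k → (m ∣ k + m * q ∸ 1) ⇔ (m ∣ k ∸ 1)
∣[k+m*q]∸1⇔∣k∸1 {m} {k} q 1≤k = mk⇔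
  (λ m∣ → ∣m+n∣m⇒∣n (subst (m ∣_) (trans shift (+-comm (k ∸ 1) (m * q))) m∣) (m∣m*n q))
  (λ m∣ → subst (m ∣_) (sym shift) (∣m∣n⇒∣m+n m∣ (m∣m*n q)))
  where
  shift : k + m * q ∸ 1 ≡ k ∸ 1 + m * q
  shift = +-∸-comm (m * q) 1≤k

ℤ-condition⇔ : ∀ p q t u →
               (ℤ.+ 2 ℤ.* ℤ.+ p ℤ.- ℤ.+ q ℤ.+ ℤ.+ t ≡ ℤ.+ u) ⇔ (u + q ≡ 2 * p + t)
ℤ-condition⇔ p q t u = mk⇔ to from
  where
  open ≡-Reasoning
  X : ℤ
  X = ℤ.+ 2 ℤ.* ℤ.+ p ℤ.- ℤ.+ q ℤ.+ ℤ.+ t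
  X+q : X ℤ.+ ℤ.+ q ≡ ℤ.+ (2 * p + t)
  X+q = begin
    X ℤ.+ ℤ.+ q                  ≡⟨ lemma (ℤ.+ 2) (ℤ.+ p) (ℤ.+ q) (ℤ.+ t) ⟩
    ℤ.+ 2 ℤ.* ℤ.+ p ℤ.+ ℤ.+ t    ≡⟨ cong (ℤ._+ ℤ.+ t) (ℤ.pos-* 2 p) ⟨
    ℤ.+ (2 * p) ℤ.+ ℤ.+ t        ≡⟨ ℤ.pos-+ (2 * p) t ⟨
    ℤ.+ (2 * p + t)              ∎
    where
    lemma : ∀ x p q t → x ℤ.* p ℤ.- q ℤ.+ t ℤ.+ q ≡ x ℤ.* p ℤ.+ t
    lemma = ℤ-Solver.solve-∀
  to : X ≡ ℤ.+ u → u + q ≡ 2 * p + t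
  to X≡u = ℤ.+-injective (begin
    ℤ.+ (u + q)       ≡⟨ ℤ.pos-+ u q ⟩
    ℤ.+ u ℤ.+ ℤ.+ q   ≡⟨ cong (ℤ._+ ℤ.+ q) X≡u ⟨
    X ℤ.+ ℤ.+ q       ≡⟨ X+q ⟩
    ℤ.+ (2 * p + t)   ∎)
  from : u + q ≡ 2 * p + t → X ≡ ℤ.+ u
  from eq = begin
    X                            ≡⟨ cancel X (ℤ.+ q) ⟨
    X ℤ.+ ℤ.+ q ℤ.- ℤ.+ q        ≡⟨ cong (ℤ._- ℤ.+ q) (trans X+q (cong ℤ.+_ (sym eq))) ⟩
    ℤ.+ (u + q) ℤ.- ℤ.+ q        ≡⟨ cong (ℤ._- ℤ.+ q) (ℤ.pos-+ u q) ⟩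
    ℤ.+ u ℤ.+ ℤ.+ q ℤ.- ℤ.+ q    ≡⟨ cancel (ℤ.+ u) (ℤ.+ q) ⟩
    ℤ.+ u                        ∎
    where
    cancel : ∀ x y → x ℤ.+ y ℤ.- y ≡ x
    cancel = ℤ-Solver.solve-∀

module Cyclic (n′ : ℕ) where

  n : ℕ
  n = suc n′

  M : ℕ
  M = 2 ^ n ∸ 1

  M+1≡2^n : M + 1 ≡ 2 ^ n
  M+1≡2^n = m∸n+n≡m (m^n>0 2 n)

  1<2^n : 1 < 2 ^ n
  1<2^n = *-monoʳ-≤ 2 (m^n>0 2 n′)

  instance
    M-nonZero : NonZero M
    M-nonZero = >-nonZero (∸-monoˡ-≤ 1 1<2^n)

  prev : ℕ → ℕ
  prev zero    = n′
  prev (suc m) = m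

  prev<n : ∀ {m} → m < n → prev m < n
  prev<n {zero}  _     = ≤-refl
  prev<n {suc m} 1+m<n = <-trans (n<1+n m) 1+m<n

  Periodic : (ℕ → ℕ) → Set
  Periodic g = ∀ x → g (x + n) ≡ g x

  -- Index m + n′ is m − 1 mod n: this is the digit rotation realising multiplication by 2 modulo M.
  value-rotate : ∀ g → Periodic g → value (λ m → g (m + n′)) n + M * g n′ ≡ 2 * value g n
  value-rotate g periodic = begin
    value (λ m → g (m + n′)) n + M * g n′                ≡⟨ cong (_+ M * g n′) (value-suc (λ m → g (m + n′)) n′) ⟩
    g n′ + 2 * value (λ m → g (suc m + n′)) n′ + M * g n′ ≡⟨ cong (λ v → g n′ + 2 * v + M * g n′) (value-cong n′ wrap) ⟩
    g n′ + 2 * value g n′ + M * g n′                     ≡⟨ lemma (g n′) (value g n′) M ⟩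
    2 * value g n′ + (M + 1) * g n′                      ≡⟨ cong (λ p → 2 * value g n′ + p * g n′) M+1≡2^n ⟩
    2 * value g n′ + 2 ^ n * g n′                        ≡⟨ lemma′ (value g n′) (2 ^ n′) (g n′) ⟩
    2 * value g n                                        ∎
    where
    open ≡-Reasoning
    wrap : ∀ m → m < n′ → g (suc m + n′) ≡ g m
    wrap m _ = trans (cong g (sym (+-suc m n′))) (periodic m)
    lemma : ∀ x v M → x + 2 * v + M * x ≡ 2 * v + (M + 1) * x
    lemma = solve-∀
    lemma′ : ∀ v p x → 2 * v + 2 * p * x ≡ 2 * (v + p * x)
    lemma′ = solve-∀

  value-rotate^ : ∀ g → Periodic g → ∀ j → ∃ λ K → value (λ m → g (m + j * n′)) n + M * K ≡ 2 ^ j * value g n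
  value-rotate^ g periodic zero = 0 , (begin
    value (λ m → g (m + 0)) n + M * 0  ≡⟨ cong₂ _+_ (value-cong n (λ m _ → cong g (+-identityʳ m))) (*-zeroʳ M) ⟩
    value g n + 0                      ≡⟨ +-identityʳ (value g n) ⟩
    value g n                          ≡⟨ *-identityˡ (value g n) ⟨
    1 * value g n                      ∎)
    where open ≡-Reasoning
  value-rotate^ g periodic (suc j) with value-rotate^ g periodic j
  ... | K , eq = h n′ + 2 * K , (begin
    value (λ m → g (m + suc j * n′)) n + M * (h n′ + 2 * K)       ≡⟨ cong (_+ M * (h n′ + 2 * K)) (value-cong n (λ m _ → cong g (+-assoc m n′ (j * n′)))) ⟨
    value (λ m → h (m + n′)) n + M * (h n′ + 2 * K)               ≡⟨ lemma (value (λ m → h (m + n′)) n) M (h n′) K ⟩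
    value (λ m → h (m + n′)) n + M * h n′ + 2 * (M * K)           ≡⟨ cong (_+ 2 * (M * K)) (value-rotate h h-periodic) ⟩
    2 * value h n + 2 * (M * K)                                   ≡⟨ *-distribˡ-+ 2 (value h n) (M * K) ⟨
    2 * (value h n + M * K)                                       ≡⟨ cong (2 *_) eq ⟩
    2 * (2 ^ j * value g n)                                       ≡⟨ *-assoc 2 (2 ^ j) (value g n) ⟨
    2 ^ suc j * value g n                                         ∎)
    where
    open ≡-Reasoning
    h : ℕ → ℕ
    h x = g (x + j * n′)
    h-periodic : Periodic h
    h-periodic x = trans (cong g (+-shuffle x n (j * n′))) (periodic (x + j * n′))
      where
      +-shuffle : ∀ x y z → x + y + z ≡ x + z + y
      +-shuffle = solve-∀
    lemma : ∀ V M x K → V + M * (x + 2 * K) ≡ V + M * x + 2 * (M * K)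
    lemma = solve-∀

  carry-sum⇔ : ∀ {S B} → (S + B ≡ 2 ^ n * B + 1) ⇔ (S ≡ B * M + 1)
  carry-sum⇔ {S} {B} = mk⇔ (λ eq → +-cancelʳ-≡ B S (B * M + 1) (trans eq shape))
                             (λ eq → trans (cong (_+ B) eq) (sym shape))
    where
    lemma : ∀ M B → (M + 1) * B + 1 ≡ B * M + 1 + B
    lemma = solve-∀
    shape : 2 ^ n * B + 1 ≡ B * M + 1 + B
    shape = trans (cong (λ p → p * B + 1) (sym M+1≡2^n)) (lemma M B)

  module CarryChain (s : ℕ → ℕ) where

    -- d m is the carry out of position m when the digit sums s m are added, the carry out of the top
    -- position being fed back into position 0, and the result digits are those of 1.
    IsCarryChain : (ℕ → Bool) → Set
    IsCarryChain d = ∀ m → m < n → s m + b2ℕ (d (prev m)) ≡ 2 * b2ℕ (d m) + δ₀ m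

    carry-chain-sum : ∀ {d} → IsCarryChain d → value s n ≡ b2ℕ (d n′) * M + 1
    carry-chain-sum {d} chain = Equivalence.to carry-sum⇔ (begin
      value s n + b2ℕ (d n′)               ≡⟨ value-carry s δ₀ (λ m → b2ℕ (d (prev m))) n step ⟩
      value δ₀ n + 2 ^ n * b2ℕ (d n′)      ≡⟨ cong (_+ 2 ^ n * b2ℕ (d n′)) (value-δ₀ n′) ⟩
      1 + 2 ^ n * b2ℕ (d n′)               ≡⟨ +-comm 1 _ ⟩
      2 ^ n * b2ℕ (d n′) + 1               ∎)
      where
      open ≡-Reasoning
      step : ∀ m → m < n → s m + b2ℕ (d (prev m)) ≡ δ₀ m + 2 * b2ℕ (d m)
      step m m<n = trans (chain m m<n) (+-comm (2 * b2ℕ (d m)) (δ₀ m))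

    carry-chain-unique : ∀ {d d′} → IsCarryChain d → IsCarryChain d′ → ∀ m → m < n → d m ≡ d′ m
    carry-chain-unique {d} {d′} chain chain′ = go
      where
      step : ∀ m → m < n → d (prev m) ≡ d′ (prev m) → d m ≡ d′ m
      step m m<n same = 2*b2ℕ+t-injective {d m} {d′ m} (δ₀ m) (begin
        2 * b2ℕ (d m) + δ₀ m     ≡⟨ chain m m<n ⟨
        s m + b2ℕ (d (prev m))   ≡⟨ cong (λ b → s m + b2ℕ b) same ⟩
        s m + b2ℕ (d′ (prev m))  ≡⟨ chain′ m m<n ⟩
        2 * b2ℕ (d′ m) + δ₀ m    ∎)
        where open ≡-Reasoning
      go : ∀ m → m < n → d m ≡ d′ m
      go zero    0<n   = step 0 0<n (b2ℕ-injective (*-cancelʳ-≡ _ _ M (+-cancelʳ-≡ 1 _ _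
                         (trans (sym (carry-chain-sum {d} chain)) (carry-chain-sum {d′} chain′)))))
      go (suc m) 1+m<n = step (suc m) 1+m<n (go m (<-trans (n<1+n m) 1+m<n))

    module _ (s≤2 : ∀ m → m < n → s m ≤ 2) {B : ℕ} (B≤1 : B ≤ 1) (sum : value s n ≡ B * M + 1) where

      private
        carry : ℕ → ℕ
        carry zero    = B
        carry (suc m) = (s m + carry m) / 2

        digit : ℕ → ℕ
        digit m = (s m + carry m) % 2

        carry≤1 : ∀ m → m ≤ n → carry m ≤ 1
        carry≤1 zero    _     = B≤1
        carry≤1 (suc m) 1+m≤n = s≤s⁻¹ (m<n*o⇒m/o<n (s≤s (+-mono-≤ (s≤2 m 1+m≤n) (carry≤1 m (<⇒≤ 1+m≤n)))))

        carry-step : ∀ m → s m + carry m ≡ digit m + 2 * carry (suc m)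
        carry-step m = trans (m≡m%n+[m/n]*n (s m + carry m) 2) (cong (digit m +_) (*-comm ((s m + carry m) / 2) 2))

        digits≡1∧carry≡B : value digit n ≡ 1 × carry n ≡ B
        digits≡1∧carry≡B = base-digit-unique (value<2^ digit n (λ m _ → s≤s⁻¹ (m%n<n (s m + carry m) 2))) 1<2^n (begin
          value digit n + 2 ^ n * carry n  ≡⟨ value-carry s digit carry n (λ m _ → carry-step m) ⟨
          value s n + B                    ≡⟨ Equivalence.from carry-sum⇔ sum ⟩
          2 ^ n * B + 1                    ≡⟨ +-comm _ 1 ⟩
          1 + 2 ^ n * B                    ∎)
          where open ≡-Reasoning

        chain : ℕ → Bool
        chain m = fromBit (carry (suc m))

        carry-in : ∀ m → m < n → b2ℕ (chain (prev m)) ≡ carry m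
        carry-in zero    _     = trans (b2ℕ-fromBit (carry≤1 n ≤-refl)) (proj₂ digits≡1∧carry≡B)
        carry-in (suc m) 1+m<n = b2ℕ-fromBit (carry≤1 (suc m) (<⇒≤ 1+m<n))

        carry-chain : IsCarryChain chain
        carry-chain m m<n = begin
          s m + b2ℕ (chain (prev m))   ≡⟨ cong (s m +_) (carry-in m m<n) ⟩
          s m + carry m                ≡⟨ carry-step m ⟩
          digit m + 2 * carry (suc m)  ≡⟨ cong₂ (λ x c → x + 2 * c) (value≡1⇒≡δ₀ digit n′ (proj₁ digits≡1∧carry≡B) m m<n)
                                                                    (sym (b2ℕ-fromBit (carry≤1 (suc m) m<n))) ⟩
          δ₀ m + 2 * b2ℕ (chain m)     ≡⟨ +-comm (δ₀ m) _ ⟩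
          2 * b2ℕ (chain m) + δ₀ m     ∎
          where open ≡-Reasoning

      carry-chain-exists : ∃ IsCarryChain
      carry-chain-exists = chain , carry-chain

    carry-chain⇔ : (∀ m → m < n → s m ≤ 2) → (∃ λ B → B ≤ 1 × value s n ≡ B * M + 1) ⇔ ∃ IsCarryChain
    carry-chain⇔ s≤2 = mk⇔ (λ (B , B≤1 , sum) → carry-chain-exists s≤2 B≤1 sum)
                           (λ (d , chain) → b2ℕ (d n′) , b2ℕ≤1 (d n′) , carry-chain-sum {d} chain)

  infix 4 _≈_
  record _≈_ (x y : ℕ) : Set where
    constructor mk≈
    field %≡% : x % n ≡ y % n
  open _≈_

  ≈-isEquivalence : IsEquivalence _≈_
  ≈-isEquivalence = record
    { refl  = mk≈ refl
    ; sym   = λ x≈y → mk≈ (sym (%≡% x≈y))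
    ; trans = λ x≈y y≈z → mk≈ (trans (%≡% x≈y) (%≡% y≈z))
    }

  ≈-setoid : Setoid 0ℓ 0ℓ
  ≈-setoid = record { isEquivalence = ≈-isEquivalence }

  open Setoid ≈-setoid public using () renaming (refl to ≈-refl; sym to ≈-sym; trans to ≈-trans; reflexive to ≈-reflexive)

  +-cong≈ : ∀ {x x′ y y′} → x ≈ x′ → y ≈ y′ → x + y ≈ x′ + y′
  +-cong≈ {x} {x′} {y} {y′} (mk≈ p) (mk≈ q) = mk≈ (begin
    (x + y) % n              ≡⟨ %-distribˡ-+ x y n ⟩
    (x % n + y % n) % n      ≡⟨ cong₂ (λ u v → (u + v) % n) p q ⟩
    (x′ % n + y′ % n) % n    ≡⟨ %-distribˡ-+ x′ y′ n ⟨
    (x′ + y′) % n            ∎)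
    where open ≡-Reasoning

  *-cong≈ : ∀ {x x′ y y′} → x ≈ x′ → y ≈ y′ → x * y ≈ x′ * y′
  *-cong≈ {x} {x′} {y} {y′} (mk≈ p) (mk≈ q) = mk≈ (begin
    (x * y) % n              ≡⟨ %-distribˡ-* x y n ⟩
    (x % n * (y % n)) % n    ≡⟨ cong₂ (λ u v → (u * v) % n) p q ⟩
    (x′ % n * (y′ % n)) % n  ≡⟨ %-distribˡ-* x′ y′ n ⟨
    (x′ * y′) % n            ∎)
    where open ≡-Reasoning

  %≈ : ∀ x → x % n ≈ x
  %≈ x = mk≈ (m%n%n≡m%n x n)

  *n≈0 : ∀ x → x * n ≈ 0
  *n≈0 x = mk≈ (m*n%n≡0 x n)

  n≈0 : n ≈ 0
  n≈0 = mk≈ (n%n≡0 n)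

  ≈⇒≡ : ∀ {x y} → x ≈ y → x < n → y < n → x ≡ y
  ≈⇒≡ {x} {y} (mk≈ p) x<n y<n = trans (sym (m<n⇒m%n≡m x<n)) (trans p (m<n⇒m%n≡m y<n))

  ≈⇒mod≡ : ∀ {x y} → x ≈ y → x mod n ≡ y mod n
  ≈⇒mod≡ {x} {y} (mk≈ p) = fromℕ<-cong (x % n) (y % n) p (m%n<n x n) (m%n<n y n)

  neg : ℕ → ℕ
  neg x = (n ∸ x % n) % n

  neg<n : ∀ x → neg x < n
  neg<n x = m%n<n (n ∸ x % n) n

  neg-cong : ∀ {x y} → x ≈ y → neg x ≡ neg y
  neg-cong (mk≈ p) = cong (λ u → (n ∸ u) % n) p

  +-neg≈0 : ∀ x → x + neg x ≈ 0
  +-neg≈0 x = begin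
    x + neg x               ≈⟨ +-cong≈ (≈-sym (%≈ x)) (%≈ (n ∸ x % n)) ⟩
    x % n + (n ∸ x % n)     ≡⟨ m+[n∸m]≡n (<⇒≤ (m%n<n x n)) ⟩
    n                       ≈⟨ n≈0 ⟩
    0                       ∎
    where open SetoidReasoning ≈-setoid

  +-cancelʳ-≈ : ∀ {x y} z → x + z ≈ y + z → x ≈ y
  +-cancelʳ-≈ {x} {y} z x+z≈y+z = begin
    x                      ≡⟨ +-identityʳ x ⟨
    x + 0                  ≈⟨ +-cong≈ (≈-refl {x}) (+-neg≈0 z) ⟨
    x + (z + neg z)        ≡⟨ +-assoc x z (neg z) ⟨
    x + z + neg z          ≈⟨ +-cong≈ x+z≈y+z (≈-refl {neg z}) ⟩
    y + z + neg z          ≡⟨ +-assoc y z (neg z) ⟩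
    y + (z + neg z)        ≈⟨ +-cong≈ (≈-refl {y}) (+-neg≈0 z) ⟩
    y + 0                  ≡⟨ +-identityʳ y ⟩
    y                      ∎
    where open SetoidReasoning ≈-setoid

  neg-unique : ∀ {x y} → y < n → y + x ≈ 0 → neg x ≡ y
  neg-unique {x} {y} y<n y+x≈0 = ≈⇒≡ (+-cancelʳ-≈ x (begin
    neg x + x     ≡⟨ +-comm (neg x) x ⟩
    x + neg x     ≈⟨ +-neg≈0 x ⟩
    0             ≈⟨ y+x≈0 ⟨
    y + x         ∎)) (neg<n x) y<n
    where open SetoidReasoning ≈-setoid

  prev+1≈ : ∀ m → prev m + 1 ≈ m
  prev+1≈ zero    = ≈-trans (≈-reflexive (+-comm n′ 1)) n≈0
  prev+1≈ (suc m) = ≈-reflexive (+-comm m 1)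

  module Index (r e : ℕ) (e*r≈1 : e * r ≈ 1) where

    -- pos i = (−ir) mod n is the bit position of a_i, so that aDigit n r a i = bit a (pos i) holds by
    -- definition; idx m = e(n − m) mod n is its inverse.
    pos : ℕ → ℕ
    pos i = neg (i * r)

    idx : ℕ → ℕ
    idx m = e * (n ∸ m) % n

    pos<n : ∀ i → pos i < n
    pos<n i = neg<n (i * r)

    idx<n : ∀ m → idx m < n
    idx<n m = m%n<n (e * (n ∸ m)) n

    pos-cong : ∀ {i j} → i ≈ j → pos i ≡ pos j
    pos-cong i≈j = neg-cong (*-cong≈ i≈j (≈-refl {r}))

    pos+ir≈0 : ∀ i → pos i + i * r ≈ 0
    pos+ir≈0 i = ≈-trans (≈-reflexive (+-comm (pos i) (i * r))) (+-neg≈0 (i * r))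

    e*[x*r]≈x : ∀ x → e * (x * r) ≈ x
    e*[x*r]≈x x = begin
      e * (x * r)   ≡⟨ lemma e x r ⟩
      e * r * x     ≈⟨ *-cong≈ e*r≈1 (≈-refl {x}) ⟩
      1 * x         ≡⟨ *-identityˡ x ⟩
      x             ∎
      where
      open SetoidReasoning ≈-setoid
      lemma : ∀ e x r → e * (x * r) ≡ e * r * x
      lemma = solve-∀

    pos-idx : ∀ {m} → m < n → pos (idx m) ≡ m
    pos-idx {m} m<n = neg-unique m<n (begin
      m + idx m * r            ≈⟨ +-cong≈ (≈-refl {m}) (*-cong≈ (%≈ (e * (n ∸ m))) (≈-refl {r})) ⟩
      m + e * (n ∸ m) * r      ≡⟨ cong (m +_) (*-assoc e (n ∸ m) r) ⟩
      m + e * ((n ∸ m) * r)    ≈⟨ +-cong≈ (≈-refl {m}) (e*[x*r]≈x (n ∸ m)) ⟩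
      m + (n ∸ m)              ≡⟨ m+[n∸m]≡n (<⇒≤ m<n) ⟩
      n                        ≈⟨ n≈0 ⟩
      0                        ∎)
      where open SetoidReasoning ≈-setoid

    idx-pos : ∀ i → idx (pos i) ≈ i
    idx-pos i = begin
      e * (n ∸ pos i) % n   ≈⟨ %≈ (e * (n ∸ pos i)) ⟩
      e * (n ∸ pos i)       ≈⟨ *-cong≈ (≈-refl {e}) n∸pos≈ir ⟩
      e * (i * r)           ≈⟨ e*[x*r]≈x i ⟩
      i                     ∎
      where
      open SetoidReasoning ≈-setoid
      n∸pos≈ir : n ∸ pos i ≈ i * r
      n∸pos≈ir = +-cancelʳ-≈ (pos i) (begin
        n ∸ pos i + pos i   ≡⟨ m∸n+n≡m (<⇒≤ (pos<n i)) ⟩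
        n                   ≈⟨ n≈0 ⟩
        0                   ≈⟨ pos+ir≈0 i ⟨
        pos i + i * r       ≡⟨ +-comm (pos i) (i * r) ⟩
        i * r + pos i       ∎)

    pos-+e : ∀ i → pos (i + e) ≡ prev (pos i)
    pos-+e i = neg-unique (prev<n (pos<n i)) (begin
      prev p + (i + e) * r     ≡⟨ lemma (prev p) i e r ⟩
      prev p + e * r + i * r   ≈⟨ +-cong≈ (+-cong≈ (≈-refl {prev p}) e*r≈1) (≈-refl {i * r}) ⟩
      prev p + 1 + i * r       ≈⟨ +-cong≈ (prev+1≈ p) (≈-refl {i * r}) ⟩
      p + i * r                ≈⟨ pos+ir≈0 i ⟩
      0                        ∎)
      where
      open SetoidReasoning ≈-setoid
      p : ℕ
      p = pos i
      lemma : ∀ q i e r → q + (i + e) * r ≡ q + e * r + i * r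
      lemma = solve-∀

    pos-suc : ∀ i → pos (suc i) ≡ (pos i + r * n′) % n
    pos-suc i = neg-unique (m%n<n (pos i + r * n′) n) (begin
      (pos i + r * n′) % n + suc i * r  ≈⟨ +-cong≈ (%≈ (pos i + r * n′)) (≈-refl {suc i * r}) ⟩
      pos i + r * n′ + suc i * r        ≡⟨ lemma (pos i) r n′ i ⟩
      pos i + i * r + r * n             ≈⟨ +-cong≈ (pos+ir≈0 i) (*n≈0 r) ⟩
      0                                 ∎)
      where
      open SetoidReasoning ≈-setoid
      lemma : ∀ p r n′ i → p + r * n′ + suc i * r ≡ p + i * r + r * suc n′
      lemma = solve-∀

    idx-prev : ∀ {m} → m < n → idx (prev m) ≈ idx m + e
    idx-prev {m} m<n = begin
      idx (prev m)                ≡⟨ cong (idx ∘ prev) (pos-idx m<n) ⟨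
      idx (prev (pos (idx m)))    ≡⟨ cong idx (pos-+e (idx m)) ⟨
      idx (pos (idx m + e))       ≈⟨ idx-pos (idx m + e) ⟩
      idx m + e                   ∎
      where open SetoidReasoning ≈-setoid

    pos≡0⇒≡0 : ∀ {i} → i < n → pos i ≡ 0 → i ≡ 0
    pos≡0⇒≡0 {i} i<n pos≡0 = ≈⇒≡ (begin
      i              ≈⟨ idx-pos i ⟨
      idx (pos i)    ≡⟨ cong idx pos≡0 ⟩
      e * n % n      ≈⟨ %≈ (e * n) ⟩
      e * n          ≈⟨ *n≈0 e ⟩
      0              ∎) i<n z<s
      where open SetoidReasoning ≈-setoid

    δ₀-pos : ∀ {i} → i < n → δ₀ (pos i) ≡ δ₀ i
    δ₀-pos {zero}  _     = cong δ₀ (n%n≡0 n)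
    δ₀-pos {suc i} 1+i<n with pos (suc i) in eq
    ... | zero  = ⊥-elim (1+n≢0 (pos≡0⇒≡0 1+i<n eq))
    ... | suc _ = refl

module Reduction (n′ r e a : ℕ) (e*r≡1 : e * r % suc n′ ≡ 1 % suc n′) where

  open Cyclic n′ public
  open Index r e (mk≈ e*r≡1)

  f : ℕ → ℕ
  f x = bit a (x % n)

  f-periodic : Periodic f
  f-periodic x = cong (bit a) ([m+n]%n≡m%n x n)

  -- Index m + r n′ is m − r mod n.
  s : ℕ → ℕ
  s m = f m + f (m + r * n′)

  open CarryChain s public

  aD : ℕ → ℕ
  aD i = aDigit n r a i

  aD-% : ∀ i → aD (i % n) ≡ aD i
  aD-% i = cong (bit a) (pos-cong (%≈ i))

  aD-pair : ∀ i → aD (suc i) + aD i ≡ s (pos i)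
  aD-pair i = begin
    aD (suc i) + aD i                 ≡⟨ cong₂ _+_ (cong (bit a) (pos-suc i)) (cong (bit a) (sym (m<n⇒m%n≡m (pos<n i)))) ⟩
    f (pos i + r * n′) + f (pos i)    ≡⟨ +-comm (f (pos i + r * n′)) (f (pos i)) ⟩
    s (pos i)                         ∎
    where open ≡-Reasoning

  digitAt : Vec Bool n → ℕ → ℕ
  digitAt c j = b2ℕ (lookup c (j mod n))

  -- Condition (b) at index i with the subtraction moved across; δ₀ i is the extra 1 at i = 0.
  CarryEq : Vec Bool n → ℕ → Set
  CarryEq c i = aD (suc i) + aD i + digitAt c (i + e) ≡ 2 * digitAt c i + δ₀ i

  b2ℤ-condition⇔ : ∀ b b′ t u →
                   (ℤ.+ 2 ℤ.* b2ℤ b ℤ.- b2ℤ b′ ℤ.+ ℤ.+ t ≡ ℤ.+ u) ⇔ (u + b2ℕ b′ ≡ 2 * b2ℕ b + t)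
  b2ℤ-condition⇔ true  true  = ℤ-condition⇔ 1 1
  b2ℤ-condition⇔ true  false = ℤ-condition⇔ 1 0
  b2ℤ-condition⇔ false true  = ℤ-condition⇔ 0 1
  b2ℤ-condition⇔ false false = ℤ-condition⇔ 0 0

  condB⇔carryEq : ∀ c → CondB n r e a c ⇔ (∀ i → i < n → CarryEq c i)
  condB⇔carryEq c = mk⇔ condB⇒ ⇒condB
    where
    open Equivalence using (to; from)
    condition⇔ : ∀ i t {u u′} → u ≡ u′ →
                 (ℤ.+ 2 ℤ.* cAt c i ℤ.- cAt c (i + e) ℤ.+ ℤ.+ t ≡ ℤ.+ u) ⇔
                 (u′ + digitAt c (i + e) ≡ 2 * digitAt c i + t)
    condition⇔ i t refl = b2ℤ-condition⇔ (lookup c (i mod n)) (lookup c ((i + e) mod n)) t _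
    pair-% : ∀ i → aD ((i + 1) % n) + aD i ≡ aD (suc i) + aD i
    pair-% i = cong (_+ aD i) (trans (aD-% (i + 1)) (cong aD (+-comm i 1)))
    condB⇒ : CondB n r e a c → ∀ i → i < n → CarryEq c i
    condB⇒ (eq₀ , _  ) zero    _     = to (condition⇔ 0 1 refl) eq₀
    condB⇒ (_   , eqs) (suc i) 1+i<n = to (condition⇔ (suc i) 0 (pair-% (suc i))) (trans (ℤ.+-identityʳ _) (eqs (suc i) z<s 1+i<n))
    ⇒condB : (∀ i → i < n → CarryEq c i) → CondB n r e a c
    ⇒condB eqs = from (condition⇔ 0 1 refl) (eqs 0 z<s) , eqs⁺
      where
      eqs⁺ : ∀ i → 0 < i → i < n → ℤ.+ 2 ℤ.* cAt c i ℤ.- cAt c (i + e) ≡ ℤ.+ (aD ((i + 1) % n) + aD i)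
      eqs⁺ (suc i) _ 1+i<n = trans (sym (ℤ.+-identityʳ _)) (from (condition⇔ (suc i) 0 (pair-% (suc i))) (eqs (suc i) 1+i<n))

  chainOf : Vec Bool n → ℕ → Bool
  chainOf c m = lookup c (idx m mod n)

  vecOf : (ℕ → Bool) → Vec Bool n
  vecOf d = tabulate (d ∘ pos ∘ toℕ)

  digitAt-vecOf : ∀ d j → digitAt (vecOf d) j ≡ b2ℕ (d (pos j))
  digitAt-vecOf d j = cong b2ℕ (begin
    lookup (vecOf d) (j mod n)   ≡⟨ lookup∘tabulate (d ∘ pos ∘ toℕ) (j mod n) ⟩
    d (pos (toℕ (j mod n)))      ≡⟨ cong (d ∘ pos) (toℕ-fromℕ< (m%n<n j n)) ⟩
    d (pos (j % n))              ≡⟨ cong d (pos-cong (%≈ j)) ⟩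
    d (pos j)                    ∎)
    where open ≡-Reasoning

  carryEq⇒carryChain : ∀ c → (∀ i → i < n → CarryEq c i) → IsCarryChain (chainOf c)
  carryEq⇒carryChain c eqs m m<n = begin
    s m + b2ℕ (chainOf c (prev m))           ≡⟨ cong₂ _+_ (sym s-pair) (cong b2ℕ carry-in) ⟩
    aD (suc i) + aD i + digitAt c (i + e)    ≡⟨ eqs i (idx<n m) ⟩
    2 * digitAt c i + δ₀ i                   ≡⟨ cong (2 * digitAt c i +_) (trans (sym (δ₀-pos (idx<n m))) (cong δ₀ pos-i)) ⟩
    2 * b2ℕ (chainOf c m) + δ₀ m             ∎
    where
    open ≡-Reasoning
    i : ℕ
    i = idx m
    pos-i : pos i ≡ m
    pos-i = pos-idx m<n
    s-pair : aD (suc i) + aD i ≡ s m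
    s-pair = trans (aD-pair i) (cong s pos-i)
    carry-in : chainOf c (prev m) ≡ lookup c ((i + e) mod n)
    carry-in = cong (lookup c) (≈⇒mod≡ (idx-prev m<n))

  carryChain⇒carryEq : ∀ {d} → IsCarryChain d → ∀ i → i < n → CarryEq (vecOf d) i
  carryChain⇒carryEq {d} chain i i<n = begin
    aD (suc i) + aD i + digitAt (vecOf d) (i + e)  ≡⟨ cong₂ _+_ (aD-pair i) carry-in ⟩
    s m + b2ℕ (d (prev m))                         ≡⟨ chain m (pos<n i) ⟩
    2 * b2ℕ (d m) + δ₀ m                           ≡⟨ cong₂ (λ x y → 2 * x + y) (sym (digitAt-vecOf d i)) (δ₀-pos i<n) ⟩
    2 * digitAt (vecOf d) i + δ₀ i                 ∎
    where
    open ≡-Reasoning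
    m : ℕ
    m = pos i
    carry-in : digitAt (vecOf d) (i + e) ≡ b2ℕ (d (prev m))
    carry-in = trans (digitAt-vecOf d (i + e)) (cong (b2ℕ ∘ d) (pos-+e i))

  vecOf-chainOf : ∀ c → vecOf (chainOf c) ≡ c
  vecOf-chainOf c = trans (tabulate-cong (cong (lookup c) ∘ idx∘pos-mod)) (tabulate∘lookup c)
    where
    idx∘pos-mod : ∀ k → idx (pos (toℕ k)) mod n ≡ k
    idx∘pos-mod k = trans (≈⇒mod≡ (idx-pos (toℕ k)))
                          (toℕ-injective (trans (toℕ-fromℕ< (m%n<n (toℕ k) n)) (m<n⇒m%n≡m (toℕ<n k))))

  vecOf-cong : ∀ {d d′} → (∀ m → m < n → d m ≡ d′ m) → vecOf d ≡ vecOf d′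
  vecOf-cong d≡d′ = tabulate-cong (λ k → d≡d′ (pos (toℕ k)) (pos<n (toℕ k)))

  condB-unique : ∀ c c′ → CondB n r e a c → CondB n r e a c′ → c ≡ c′
  condB-unique c c′ h h′ = begin
    c                   ≡⟨ vecOf-chainOf c ⟨
    vecOf (chainOf c)   ≡⟨ vecOf-cong (carry-chain-unique {chainOf c} {chainOf c′} (chain c h) (chain c′ h′)) ⟩
    vecOf (chainOf c′)  ≡⟨ vecOf-chainOf c′ ⟩
    c′                  ∎
    where
    open ≡-Reasoning
    chain : ∀ c → CondB n r e a c → IsCarryChain (chainOf c)
    chain c h = carryEq⇒carryChain c (Equivalence.to (condB⇔carryEq c) h)

  ∃condB⇔∃carryChain : (∃ λ c → CondB n r e a c) ⇔ ∃ IsCarryChain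
  ∃condB⇔∃carryChain = mk⇔
    (λ (c , h) → chainOf c , carryEq⇒carryChain c (Equivalence.to (condB⇔carryEq c) h))
    (λ (d , chain) → vecOf d , Equivalence.from (condB⇔carryEq (vecOf d)) (carryChain⇒carryEq {d} chain))

  module Bounds (1≤a : 1 ≤ a) (a≤2^n∸2 : a ≤ 2 ^ n ∸ 2) where

    rotated : ℕ
    rotated = value (λ m → f (m + r * n′)) n

    f≤1 : ∀ x → f x ≤ 1
    f≤1 x = bit≤1 a (x % n)

    s≤2 : ∀ m → m < n → s m ≤ 2
    s≤2 m _ = +-mono-≤ (f≤1 m) (f≤1 (m + r * n′))

    a<M : a < M
    a<M = ≤-<-trans (subst (a ≤_) (sym (∸-+-assoc (2 ^ n) 1 1)) a≤2^n∸2) (∸-monoʳ-< z<s (>-nonZero⁻¹ M))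

    value-f : value f n ≡ a
    value-f = trans (value-cong n (λ m m<n → cong (bit a) (m<n⇒m%n≡m m<n)))
                    (value-bit n a (<-≤-trans a<M (m∸n≤m (2 ^ n) 1)))

    rotated≤M : rotated ≤ M
    rotated≤M = s≤s⁻¹ (subst (rotated <_) (trans (sym M+1≡2^n) (+-comm M 1)) (value<2^ _ n (λ m _ → f≤1 (m + r * n′))))

    sum≡a+rotated : value s n ≡ a + rotated
    sum≡a+rotated = trans (value-+ f (λ m → f (m + r * n′)) n) (cong (_+ rotated) value-f)

    1≤sum : 1 ≤ value s n
    1≤sum = subst (1 ≤_) (sym sum≡a+rotated) (≤-trans 1≤a (m≤m+n a rotated))

    sum≤M+M : value s n ≤ M + M
    sum≤M+M = subst (_≤ M + M) (sym sum≡a+rotated) (+-mono-≤ (<⇒≤ a<M) rotated≤M)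

    aG≡sum+M*K : ∃ λ K → a * (2 ^ r + 1) ≡ value s n + M * K
    aG≡sum+M*K with value-rotate^ f f-periodic r
    ... | K , rotation = K , (begin
      a * (2 ^ r + 1)              ≡⟨ lemma₁ a (2 ^ r) ⟩
      2 ^ r * a + a                ≡⟨ cong (λ v → 2 ^ r * v + a) value-f ⟨
      2 ^ r * value f n + a        ≡⟨ cong (_+ a) rotation ⟨
      rotated + M * K + a          ≡⟨ lemma₂ rotated (M * K) a ⟩
      a + rotated + M * K          ≡⟨ cong (_+ M * K) sum≡a+rotated ⟨
      value s n + M * K            ∎)
      where
      open ≡-Reasoning
      lemma₁ : ∀ a p → a * (p + 1) ≡ p * a + a
      lemma₁ = solve-∀
      lemma₂ : ∀ x y a → x + y + a ≡ a + x + y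
      lemma₂ = solve-∀

    M∣aG∸1⇔M∣sum∸1 : (M ∣ a * (2 ^ r + 1) ∸ 1) ⇔ (M ∣ value s n ∸ 1)
    M∣aG∸1⇔M∣sum∸1 with aG≡sum+M*K
    ... | K , aG≡ = subst (λ x → (M ∣ x ∸ 1) ⇔ (M ∣ value s n ∸ 1)) (sym aG≡) (∣[k+m*q]∸1⇔∣k∸1 K 1≤sum)

theorem3 : (n r : ℕ) → .{{_ : NonZero n}} → 1 ≤ r → Coprime r n →
    (e : ℕ) → 1 ≤ e → e ≤ n → (e * r) % n ≡ 1 % n →
    (a : ℕ) → 1 ≤ a → a ≤ 2 ^ n ∸ 2 →
    (((2 ^ n ∸ 1) ∣ (a * (2 ^ r + 1) ∸ 1)) ⇔ ∃ (λ (c : Vec Bool n) → CondB n r e a c))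
    × (∀ (c c′ : Vec Bool n) → CondB n r e a c → CondB n r e a c′ → c ≡ c′)
theorem3 (suc n′) r _ _ e _ _ e*r≡1 a 1≤a a≤2^n∸2 = divisibility⇔condB , condB-unique
  where
  open Reduction n′ r e a e*r≡1
  open Bounds 1≤a a≤2^n∸2
  open SetoidReasoning (⇔-setoid 0ℓ)
  divisibility⇔condB : (M ∣ a * (2 ^ r + 1) ∸ 1) ⇔ ∃ (λ (c : Vec Bool n) → CondB n r e a c)
  divisibility⇔condB = begin
    (M ∣ a * (2 ^ r + 1) ∸ 1)                    ≈⟨ M∣aG∸1⇔M∣sum∸1 ⟩
    (M ∣ value s n ∸ 1)                          ≈⟨ ∣∸1⇔ 1≤sum sum≤M+M ⟩
    (∃ λ B → B ≤ 1 × value s n ≡ B * M + 1)      ≈⟨ carry-chain⇔ s≤2 ⟩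
    ∃ IsCarryChain                               ≈⟨ ∃condB⇔∃carryChain ⟨
    ∃ (λ c → CondB n r e a c)                    ∎
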